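{- Let $m$ be a positive integer, let $r,t$ be integers with $0\leq r\leq t\leq m$ and $t\geq 1$, and let $s_1,\dots,s_t$ be positive integers such that $s_1,\dots,s_r$ are even, $s_{r+1},\dots,s_t$ are odd, and $s_t\mid\cdots\mid s_1$. Put $\rho:=\operatorname{lcm}(s_1,2)$. Let $k$ be a positive integer with $k\mid\rho$, let $q\in k+\rho\mathbb{Z}_{\geq 0}$, and put $d_i:=\gcd(k,s_i)$ for $1\leq i\leq t$. Let $h$ be an integer with $1\leq h\leq t$, and suppose $x_1,\dots,x_{h-1}\in\mathbb{Z}_q$ satisfy $s_ix_i\neq 0$ for $1\leq i\leq h-1$, and $x_i-x_j\neq 0$ and $x_i+x_j\neq 0$ for $1\leq i<j\leq h-1$. In addition, if $k$ is even and $r+1\leq h-1$, assume $x_i\neq \frac{q}{2}$ for $r+1\leq i\leq h-1$. Then $$\#\left(\{x\in\mathbb{Z}_q\mid s_hx=0\}\cup\{x_i,-x_i\mid 1\leq i\leq h-1\}\right)=d_h+2h-2.$$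
   Context: $\mathbb{Z}_q:=\mathbb{Z}/q\mathbb{Z}$; for an integer $s$ and $x\in\mathbb{Z}_q$, $sx$ is the integer multiple in $\mathbb{Z}_q$; when $q$ is even, $\frac{q}{2}$ denotes the class of the integer $q/2$ in $\mathbb{Z}_q$. Note $k$ is even if and only if $q$ is even, since $\rho$ is even. -}

module Defs where

open import Data.Nat using (ℕ; suc; _+_; _*_; _∸_)
open import Data.Nat.Divisibility using (_∣_; _∣?_)
open import Data.Fin using (Fin; toℕ)
open import Data.Fin.Properties using (_≟_)
open import Data.List using (List; map; upTo; filter; length; allFin)
open import Data.List.Relation.Unary.Any using (Any; any?)
open import Data.Sum using (_⊎_)
open import Relation.Binary.PropositionalEquality using (_≡_)
open import Relation.Nullary.Decidable using (Dec; _⊎-dec_)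

-- Z_q is modelled by Fin q (canonical residues 0..q-1).
-- For y ∈ Z_q and integer s:   s y = 0 in Z_q  iff  q ∣ s * toℕ y.
-- y = - x in Z_q              iff  q ∣ toℕ y + toℕ x.

idx : ℕ → List ℕ
idx h = map suc (upTo (h ∸ 1))

InSet : (q : ℕ) (s : ℕ → ℕ) (h : ℕ) (x : ℕ → Fin q) → Fin q → Set
InSet q s h x y =
  (q ∣ s h * toℕ y) ⊎ Any (λ i → (y ≡ x i) ⊎ (q ∣ toℕ y + toℕ (x i))) (idx h)

inSet? : (q : ℕ) (s : ℕ → ℕ) (h : ℕ) (x : ℕ → Fin q) (y : Fin q) → Dec (InSet q s h x y)
inSet? q s h x y =
  (q ∣? (s h * toℕ y)) ⊎-dec any? (λ i → (y ≟ x i) ⊎-dec (q ∣? (toℕ y + toℕ (x i)))) (idx h)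

cardSet : (q : ℕ) (s : ℕ → ℕ) (h : ℕ) (x : ℕ → Fin q) → ℕ
cardSet q s h x = length (filter (inSet? q s h x) (allFin q))

{-# OPTIONS --safe #-}
module Submission where

-- Identify ℤ_q with the residues 0, …, q − 1. The set is the disjoint union of the
-- annihilator {y | s_h y = 0} and the pairs {x_i, −x_i}. The annihilator consists of the
-- multiples of q / gcd(q, s_h), so it has gcd(q, s_h) = gcd(k, s_h) elements, as
-- s_h ∣ s_1 ∣ ρ ∣ q − k. Each pair has two elements because 2x_i ≠ 0 (s_i is even, or
-- x_i ≠ q/2), it misses the annihilator because s_h ∣ s_i and s_i x_i ≠ 0, and distinct
-- pairs are disjoint because x_i ∓ x_j ≠ 0.

open import Defs
open import Data.Nat using (ℕ; suc; _+_; _*_; _∸_; _≤_; _<_; _/_)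
open import Data.Nat.Divisibility using (_∣_)
open import Data.Nat.GCD using (gcd)
open import Data.Nat.LCM using (lcm)
open import Data.Fin using (Fin; toℕ)
open import Data.Product using (∃)
open import Relation.Binary.PropositionalEquality using (_≡_; _≢_)
open import Relation.Nullary using (¬_)

open import Data.Bool using (true; false; if_then_else_)
open import Data.Empty using (⊥)
open import Data.Fin using (zero; suc)
open import Data.Fin.Properties using (toℕ-injective; toℕ<n)
open import Data.List using (List; []; _∷_; length; map; upTo; filter; tabulate)
open import Data.List.Properties using (length-map; length-applyUpTo)
open import Data.List.Relation.Unary.All as All using (All; []; _∷_)
open import Data.List.Relation.Unary.All.Properties as All using (All¬⇒¬Any)
open import Data.List.Relation.Unary.AllPairs as AllPairs using (AllPairs; []; _∷_)
import Data.List.Relation.Unary.AllPairs.Properties as AllPairs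
open import Data.List.Relation.Unary.Any as Any using (Any; any?; toSum; fromSum)
import Data.List.Relation.Unary.Any.Properties as Any
open import Data.Nat using (zero; suc; z≤n; s≤s; z<s; s<s; _≟_; _≤?_)
open import Data.Nat using (NonZero; ≢-nonZero; ≢-nonZero⁻¹; >-nonZero; >-nonZero⁻¹)
open import Data.Nat.Properties
open import Data.Nat.Divisibility
open import Data.Nat.DivMod using (m/n*n≡m; m*[n/m]≡n; m*n/n≡m)
open import Data.Nat.GCD using (gcd[m,n]∣m; gcd[m,n]∣n; gcd[m,n]≢0; m/gcd[m,n]≢0; gcd-greatest)
open import Data.Nat.Coprimality using (coprime-/gcd; coprime-divisor)
open import Data.Nat.LCM using (m∣lcm[m,n]; n∣lcm[m,n])
open import Data.Product using (_×_; _,_)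
open import Data.Sum using (_⊎_; inj₁; inj₂; map₁; map₂)
open import Function using (id; _⇔_; mk⇔)
open import Level using (Level)
open import Relation.Nullary using (Dec; yes; no; does; contradiction)
open import Relation.Nullary.Decidable using (_⊎-dec_; does-⇔)
open import Relation.Unary using (Pred; Decidable)
open import Relation.Binary using (Rel)
open import Relation.Binary.PropositionalEquality
  using (refl; sym; trans; cong; cong₂; subst; subst₂; module ≡-Reasoning)
open import Algebra.Properties.CommutativeSemigroup +-commutativeSemigroup using (interchange)
open import Algebra.Properties.CommutativeSemigroup *-commutativeSemigroup using (xy∙z≈xz∙y)

private variable
  a b p p′ ℓ : Level
  A : Set a
  B : Set b
  P : Pred ℕ p
  Q : Pred ℕ p′
  c d m n q : ℕ

∣∧<⇒≡0 : d ∣ m → m < d → m ≡ 0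
∣∧<⇒≡0 {m = zero}  _   _   = refl
∣∧<⇒≡0 {m = suc _} d∣m m<d = contradiction d∣m (>⇒∤ m<d)

∣-between⇒≡ : d ∣ m → 0 < m → m < d + d → m ≡ d
∣-between⇒≡ (divides zero refl) () _
∣-between⇒≡ (divides (suc zero) refl) _ _ = +-identityʳ _
∣-between⇒≡ {d} (divides (suc (suc k)) refl) _ m<2d =
  contradiction m<2d (≤⇒≯ (+-monoʳ-≤ d (m≤m+n d (k * d))))

∣*⇔/gcd∣ : ∀ m n {y} .{{_ : NonZero (gcd m n)}} → m ∣ n * y ⇔ m / gcd m n ∣ y
∣*⇔/gcd∣ m n {y} = mk⇔
  (λ m∣ny → coprime-divisor (coprime-/gcd m n) (*-cancelʳ-∣ g (subst₂ _∣_ m≡ ny≡ m∣ny)))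
  (λ m′∣y → subst₂ _∣_ (sym m≡) (sym ny≡) (*-monoˡ-∣ g (∣n⇒∣m*n (n / g) m′∣y)))
  where
  g : ℕ
  g = gcd m n
  m≡ : m ≡ m / g * g
  m≡ = sym (m/n*n≡m (gcd[m,n]∣m m n))
  ny≡ : n * y ≡ n / g * y * g
  ny≡ = trans (cong (_* y) (sym (m/n*n≡m (gcd[m,n]∣n m n)))) (xy∙z≈xz∙y (n / g) g y)

gcd[m+n,o]≡gcd[m,o] : ∀ m {n o} → o ∣ n → gcd (m + n) o ≡ gcd m o
gcd[m+n,o]≡gcd[m,o] m {n} {o} o∣n = ∣-antisym
  (gcd-greatest (∣m+n∣m⇒∣n (subst (gcd (m + n) o ∣_) (+-comm m n) (gcd[m,n]∣m (m + n) o))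
                           (∣-trans (gcd[m,n]∣n (m + n) o) o∣n))
                (gcd[m,n]∣n (m + n) o))
  (gcd-greatest (∣m∣n⇒∣m+n (gcd[m,n]∣m m o) (∣-trans (gcd[m,n]∣n m o) o∣n)) (gcd[m,n]∣n m o))

∣-descending-chain : ∀ {t} (f : ℕ → ℕ) → (∀ i → 1 ≤ i → i < t → f (suc i) ∣ f i) →
                     ∀ {i j} → 1 ≤ i → i ≤ j → j ≤ t → f j ∣ f i
∣-descending-chain f step {i} {zero} 1≤i i≤0 _ = contradiction (≤-trans 1≤i i≤0) λ ()
∣-descending-chain f step {i} {suc j} 1≤i i≤1+j 1+j≤t with m≤n⇒m<n∨m≡n i≤1+j
... | inj₂ refl = ∣-refl
... | inj₁ (s≤s i≤j) =
  ∣-trans (step j (≤-trans 1≤i i≤j) 1+j≤t) (∣-descending-chain f step 1≤i i≤j (<⇒≤ 1+j≤t))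

m+m≡m*2 : ∀ m → m + m ≡ m * 2
m+m≡m*2 m = trans (cong (m +_) (sym (+-identityʳ m))) (*-comm 2 m)

m+n*2≡m+2*[1+n]∸2 : ∀ m n → m + n * 2 ≡ m + 2 * suc n ∸ 2
m+n*2≡m+2*[1+n]∸2 m n = begin
  m + n * 2            ≡⟨ cong (m +_) (*-comm n 2) ⟩
  m + (2 + 2 * n ∸ 2)  ≡⟨ cong (λ z → m + (z ∸ 2)) (*-suc 2 n) ⟨
  m + (2 * suc n ∸ 2)  ≡⟨ +-∸-assoc m (*-monoʳ-≤ 2 (s≤s z≤n)) ⟨
  m + 2 * suc n ∸ 2    ∎
  where open ≡-Reasoning

2∣n⇒m+m∣n*m : ∀ {m n} → 2 ∣ n → m + m ∣ n * m
2∣n⇒m+m∣n*m {m} (divides k refl) =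
  divides k (trans (*-assoc k 2 m) (cong (k *_) (cong (m +_) (+-identityʳ m))))

indicator : Dec A → ℕ
indicator a? = if does a? then 1 else 0

indicator-cong : A ⇔ B → (a? : Dec A) (b? : Dec B) → indicator a? ≡ indicator b?
indicator-cong A⇔B a? b? = cong (λ x → if x then 1 else 0) (does-⇔ A⇔B a? b?)

indicator-⊎ : (A → B → ⊥) → (a? : Dec A) (b? : Dec B) →
              indicator (a? ⊎-dec b?) ≡ indicator a? + indicator b?
indicator-⊎ disjoint (yes a) (yes b) = contradiction b (disjoint a)
indicator-⊎ disjoint (yes _) (no _)  = refl
indicator-⊎ disjoint (no _)  (yes _) = refl
indicator-⊎ disjoint (no _)  (no _)  = refl

count : Decidable P → ℕ → ℕ
count P? zero    = 0
count P? (suc n) = indicator (P? 0) + count (λ y → P? (suc y)) n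

count-cong : (P? : Decidable P) (Q? : Decidable Q) →
             (∀ {y} → y < n → P y ⇔ Q y) → count P? n ≡ count Q? n
count-cong {n = zero}  P? Q? P⇔Q = refl
count-cong {n = suc n} P? Q? P⇔Q = cong₂ _+_
  (indicator-cong (P⇔Q z<s) (P? 0) (Q? 0))
  (count-cong (λ y → P? (suc y)) (λ y → Q? (suc y)) (λ y<n → P⇔Q (s<s y<n)))

count-none : (P? : Decidable P) → (∀ {y} → y < n → ¬ P y) → count P? n ≡ 0
count-none {n = zero}  P? ¬P = refl
count-none {n = suc n} P? ¬P with P? 0
... | yes P0 = contradiction P0 (¬P z<s)
... | no _   = count-none (λ y → P? (suc y)) (λ y<n → ¬P (s<s y<n))

count-⊎ : (P? : Decidable P) (Q? : Decidable Q) → (∀ y → P y → Q y → ⊥) →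
          ∀ n → count (λ y → P? y ⊎-dec Q? y) n ≡ count P? n + count Q? n
count-⊎ P? Q? disjoint zero    = refl
count-⊎ P? Q? disjoint (suc n) = trans
  (cong₂ _+_ (indicator-⊎ (disjoint 0) (P? 0) (Q? 0))
             (count-⊎ (λ y → P? (suc y)) (λ y → Q? (suc y)) (λ y → disjoint (suc y)) n))
  (interchange (indicator (P? 0)) (indicator (Q? 0)) _ _)

count-+ : (P? : Decidable P) → ∀ m n →
          count P? (m + n) ≡ count P? m + count (λ y → P? (m + y)) n
count-+ P? zero    n = refl
count-+ P? (suc m) n = trans (cong (indicator (P? 0) +_) (count-+ (λ y → P? (suc y)) m n))
                             (sym (+-assoc (indicator (P? 0)) _ _))

count-periodic : (P? : Decidable P) → (∀ y → P (n + y) ⇔ P y) →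
                 ∀ m → count P? (m * n) ≡ m * count P? n
count-periodic P? period zero    = refl
count-periodic {n = n} P? period (suc m) = begin
  count P? (n + m * n)                           ≡⟨ count-+ P? n (m * n) ⟩
  count P? n + count (λ y → P? (n + y)) (m * n)
    ≡⟨ cong (count P? n +_) (count-cong {n = m * n} _ P? (λ {y} _ → period y)) ⟩
  count P? n + count P? (m * n)
    ≡⟨ cong (count P? n +_) (count-periodic P? period m) ⟩
  count P? n + m * count P? n                    ∎
  where open ≡-Reasoning

count-≡ : c < n → count (_≟ c) n ≡ 1
count-≡ {zero}  {suc n} _ = cong suc (count-none {n = n} (λ y → suc y ≟ 0) (λ _ ()))
count-≡ {suc c} {suc n} (s<s c<n) = trans
  (count-cong {n = n} (λ y → suc y ≟ suc c) (_≟ c) (λ _ → mk⇔ suc-injective (cong suc)))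
  (count-≡ c<n)

count-any : {I : Set a} {E : I → Pred ℕ ℓ} (E? : ∀ i → Decidable (E i)) {is : List I} →
            All (λ i → count (E? i) n ≡ c) is →
            AllPairs (λ i j → ∀ {y} → E i y → E j y → ⊥) is →
            count (λ y → any? (λ i → E? i y) is) n ≡ length is * c
count-any {n = n} E? [] [] = count-none {n = n} _ (λ _ ())
count-any {n = n} {c} E? {i ∷ is} (count≡c ∷ counts≡c) (disjoint ∷ pairwise) = begin
  count (λ y → any? (λ i → E? i y) (i ∷ is)) n
    ≡⟨ count-cong {n = n} _ _ (λ _ → mk⇔ toSum fromSum) ⟩
  count (λ y → E? i y ⊎-dec any? (λ i → E? i y) is) n
    ≡⟨ count-⊎ (E? i) _ (λ _ Eiy → All¬⇒¬Any (All.map (λ disj → disj Eiy) disjoint)) n ⟩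
  count (E? i) n + count (λ y → any? (λ i → E? i y) is) n
    ≡⟨ cong₂ _+_ count≡c (count-any {n = n} E? counts≡c pairwise) ⟩
  c + length is * c ∎
  where open ≡-Reasoning

count-∣ : ∀ d .{{_ : NonZero d}} → count (d ∣?_) d ≡ 1
count-∣ d = trans
  (count-cong (d ∣?_) (_≟ 0) (λ y<d → mk⇔ (λ d∣y → ∣∧<⇒≡0 d∣y y<d) (λ { refl → d ∣0 })))
  (count-≡ (>-nonZero⁻¹ d))

count-annihilator : ∀ m n .{{_ : NonZero m}} → count (λ y → m ∣? n * y) m ≡ gcd m n
count-annihilator m n = begin
  count (λ y → m ∣? n * y) m  ≡⟨ count-cong {n = m} _ (m′ ∣?_) (λ _ → ∣*⇔/gcd∣ m n) ⟩
  count (m′ ∣?_) m            ≡⟨ cong (count (m′ ∣?_)) (sym (m*[n/m]≡n (gcd[m,n]∣m m n))) ⟩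
  count (m′ ∣?_) (g * m′)     ≡⟨ count-periodic (m′ ∣?_) period g ⟩
  g * count (m′ ∣?_) m′       ≡⟨ cong (g *_) (count-∣ m′) ⟩
  g * 1                       ≡⟨ *-identityʳ g ⟩
  g                           ∎
  where
  open ≡-Reasoning
  g : ℕ
  g = gcd m n
  instance
    g≢0 : NonZero g
    g≢0 = ≢-nonZero (gcd[m,n]≢0 m n (inj₁ (≢-nonZero⁻¹ m)))
  m′ : ℕ
  m′ = m / g
  instance
    m′≢0 : NonZero m′
    m′≢0 = ≢-nonZero (m/gcd[m,n]≢0 m n)
  period : ∀ y → m′ ∣ m′ + y ⇔ m′ ∣ y
  period y = mk⇔ (λ m′∣m′+y → ∣m+n∣m⇒∣n m′∣m′+y ∣-refl) (∣m∣n⇒∣m+n ∣-refl)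

∣+⇔≡∸ : ∀ {y a} → y < q → 0 < a → a < q → q ∣ y + a ⇔ y ≡ q ∸ a
∣+⇔≡∸ {q} {y} {a} y<q 0<a a<q = mk⇔
  (λ q∣y+a → trans (sym (m+n∸n≡m y a))
                   (cong (_∸ a) (∣-between⇒≡ q∣y+a (<-≤-trans 0<a (m≤n+m a y)) (+-mono-< y<q a<q))))
  (λ y≡q∸a → subst (λ z → q ∣ z + a) (sym y≡q∸a) (subst (q ∣_) (sym (m∸n+n≡m (<⇒≤ a<q))) ∣-refl))

∣+-cancel-≤ : ∀ {a b y} → a ≤ b → b < q → q ∣ y + a → q ∣ y + b → b ≤ a
∣+-cancel-≤ {q} {a} {b} {y} a≤b b<q q∣y+a q∣y+b =
  m∸n≡0⇒m≤n (∣∧<⇒≡0 q∣b∸a (≤-<-trans (m∸n≤m b a) b<q))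
  where
  y+b≡y+a+[b∸a] : y + b ≡ y + a + (b ∸ a)
  y+b≡y+a+[b∸a] = trans (cong (y +_) (sym (m+[n∸m]≡n a≤b))) (sym (+-assoc y a (b ∸ a)))
  q∣b∸a : q ∣ b ∸ a
  q∣b∸a = ∣m+n∣m⇒∣n (subst (q ∣_) y+b≡y+a+[b∸a] q∣y+b) q∣y+a

∣+-cancel : ∀ {a b y} → a < q → b < q → q ∣ y + a → q ∣ y + b → a ≡ b
∣+-cancel {a = a} {b} a<q b<q q∣y+a q∣y+b with ≤-total a b
... | inj₁ a≤b = ≤-antisym a≤b (∣+-cancel-≤ a≤b b<q q∣y+a q∣y+b)
... | inj₂ b≤a = ≤-antisym (∣+-cancel-≤ b≤a a<q q∣y+b q∣y+a) b≤a

¬∣m+m⇒m>0 : ¬ d ∣ m + m → 0 < m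
¬∣m+m⇒m>0 {d} {m} d∤2m = n≢0⇒n>0 (λ { refl → d∤2m (d ∣0) })

-- In ℤ_q, 2a = 0 with a ≠ 0 forces a = q/2.
¬∣a+a : ∀ {s a} → a < q → ¬ q ∣ s * a → 2 ∣ s ⊎ (2 ∣ q → a ≢ q / 2) → ¬ q ∣ a + a
¬∣a+a {q} {s} {a} a<q q∤sa parity q∣2a = case parity
  where
  2a≡q : a + a ≡ q
  2a≡q = ∣-between⇒≡ q∣2a (+-mono-< 0<a 0<a) (+-mono-< a<q a<q)
    where
    0<a : 0 < a
    0<a = n≢0⇒n>0 (λ { refl → q∤sa (subst (q ∣_) (sym (*-zeroʳ s)) (q ∣0)) })
  case : 2 ∣ s ⊎ (2 ∣ q → a ≢ q / 2) → ⊥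
  case (inj₁ 2∣s)   = q∤sa (subst (_∣ s * a) 2a≡q (2∣n⇒m+m∣n*m 2∣s))
  case (inj₂ a≢q/2) = a≢q/2 (divides a q≡a*2) (sym (trans (cong (_/ 2) q≡a*2) (m*n/n≡m a 2)))
    where
    q≡a*2 : q ≡ a * 2
    q≡a*2 = trans (sym 2a≡q) (m+m≡m*2 a)

infix 4 _≡±_ _≡±?_

_≡±_ : ℕ → Fin q → Set
_≡±_ {q} y x = y ≡ toℕ x ⊎ q ∣ y + toℕ x

_≡±?_ : ∀ y (x : Fin q) → Dec (y ≡± x)
_≡±?_ {q} y x = (y ≟ toℕ x) ⊎-dec (q ∣? y + toℕ x)

count-± : (x : Fin q) → ¬ q ∣ toℕ x + toℕ x → count (_≡±? x) q ≡ 2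
count-± {q} x q∤2x = begin
  count (_≡±? x) q
    ≡⟨ count-⊎ (_≟ toℕ x) (λ y → q ∣? y + toℕ x) (λ { _ refl → q∤2x }) q ⟩
  count (_≟ toℕ x) q + count (λ y → q ∣? y + toℕ x) q
    ≡⟨ cong (count (_≟ toℕ x) q +_)
            (count-cong (λ y → q ∣? y + toℕ x) (_≟ q ∸ toℕ x) (λ y<q → ∣+⇔≡∸ y<q 0<x (toℕ<n x))) ⟩
  count (_≟ toℕ x) q + count (_≟ q ∸ toℕ x) q
    ≡⟨ cong₂ _+_ (count-≡ (toℕ<n x)) (count-≡ (∸-monoʳ-< 0<x (<⇒≤ (toℕ<n x)))) ⟩
  2 ∎
  where
  open ≡-Reasoning
  0<x : 0 < toℕ x
  0<x = ¬∣m+m⇒m>0 q∤2x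

annihilator-disjoint-± : ∀ {s y} {x : Fin q} → ¬ q ∣ s * toℕ x → q ∣ s * y → ¬ y ≡± x
annihilator-disjoint-± q∤sx q∣sy (inj₁ refl) = q∤sx q∣sy
annihilator-disjoint-± {q} {s} {y} {x} q∤sx q∣sy (inj₂ q∣y+x) =
  q∤sx (∣m+n∣m⇒∣n (subst (q ∣_) (*-distribˡ-+ s y (toℕ x)) (∣n⇒∣m*n s q∣y+x)) q∣sy)

±-disjoint : ∀ {y} {x x′ : Fin q} → x ≢ x′ → ¬ q ∣ toℕ x + toℕ x′ → y ≡± x → ¬ y ≡± x′
±-disjoint x≢x′ _ (inj₁ refl) (inj₁ x≡x′) = x≢x′ (toℕ-injective x≡x′)
±-disjoint _ q∤x+x′ (inj₁ refl) (inj₂ q∣x+x′) = q∤x+x′ q∣x+x′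
±-disjoint {q} {x = x} {x′} _ q∤x+x′ (inj₂ q∣x′+x) (inj₁ refl) =
  q∤x+x′ (subst (q ∣_) (+-comm (toℕ x′) (toℕ x)) q∣x′+x)
±-disjoint {x = x} {x′} x≢x′ _ (inj₂ q∣y+x) (inj₂ q∣y+x′) =
  x≢x′ (toℕ-injective (∣+-cancel (toℕ<n x) (toℕ<n x′) q∣y+x q∣y+x′))

count-annihilator∪± : ∀ q s .{{_ : NonZero q}} {xs : List (Fin q)} →
  All (λ x → ¬ q ∣ s * toℕ x) xs →
  All (λ x → ¬ q ∣ toℕ x + toℕ x) xs →
  AllPairs (λ x x′ → x ≢ x′ × ¬ q ∣ toℕ x + toℕ x′) xs →
  count (λ y → (q ∣? s * y) ⊎-dec any? (y ≡±?_) xs) q ≡ gcd q s + length xs * 2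
count-annihilator∪± q s sx≢0 2x≢0 pairwise = trans
  (count-⊎ (λ y → q ∣? s * y) _
    (λ _ q∣sy → All¬⇒¬Any (All.map (λ q∤sx → annihilator-disjoint-± {s = s} q∤sx q∣sy) sx≢0)) q)
  (cong₂ _+_ (count-annihilator q s)
             (count-any {n = q} (λ x → _≡±? x) (All.map (λ {x} → count-± x) 2x≢0)
                        (AllPairs.map (λ (x≢x′ , q∤x+x′) {y} → ±-disjoint {y = y} x≢x′ q∤x+x′)
                                      pairwise)))

length-filter-∷ : {P : Pred A p} (P? : Decidable P) (x : A) (xs : List A) →
                  length (filter P? (x ∷ xs)) ≡ indicator (P? x) + length (filter P? xs)
length-filter-∷ P? x xs with does (P? x)
... | true  = refl
... | false = refl

length-filter-tabulate : {P : Pred A p} (P? : Decidable P) (Q? : Decidable Q) (f : Fin n → A) →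
                         (∀ i → P (f i) ⇔ Q (toℕ i)) → length (filter P? (tabulate f)) ≡ count Q? n
length-filter-tabulate {n = zero}  P? Q? f P⇔Q = refl
length-filter-tabulate {n = suc n} P? Q? f P⇔Q = trans
  (length-filter-∷ P? (f zero) (tabulate (λ i → f (suc i))))
  (cong₂ _+_ (indicator-cong (P⇔Q zero) (P? (f zero)) (Q? 0))
             (length-filter-tabulate P? (λ y → Q? (suc y)) (λ i → f (suc i)) (λ i → P⇔Q (suc i))))

InSet⇔ : ∀ q s h (x : ℕ → Fin q) (y : Fin q) →
         InSet q s h x y ⇔ (q ∣ s h * toℕ y ⊎ Any (toℕ y ≡±_) (map x (idx h)))
InSet⇔ q s h x y = mk⇔
  (map₂ (λ any → Any.map⁺ (Any.map (map₁ (cong toℕ)) any)))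
  (map₂ (λ any → Any.map (map₁ toℕ-injective) (Any.map⁻ any)))

cardSet≡count : ∀ q s h (x : ℕ → Fin q) →
  cardSet q s h x ≡ count (λ y → (q ∣? s h * y) ⊎-dec any? (y ≡±?_) (map x (idx h))) q
cardSet≡count q s h x = length-filter-tabulate (inSet? q s h x) _ id (InSet⇔ q s h x)

All-idx : ∀ {P : Pred ℕ p} h → (∀ i → 1 ≤ i → i ≤ h ∸ 1 → P i) → All P (idx h)
All-idx h Pᵢ = All.map⁺ (All.applyUpTo⁺₁ id (h ∸ 1) (λ {i} → Pᵢ (suc i) (s≤s z≤n)))

AllPairs-idx : ∀ {R : Rel ℕ ℓ} h → (∀ i j → 1 ≤ i → i < j → j ≤ h ∸ 1 → R i j) → AllPairs R (idx h)
AllPairs-idx h Rᵢⱼ = AllPairs.map⁺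
  (AllPairs.applyUpTo⁺₁ id (h ∸ 1) (λ {i} {j} i<j → Rᵢⱼ (suc i) (suc j) (s≤s z≤n) (s<s i<j)))

length-idx : ∀ h → length (idx h) ≡ h ∸ 1
length-idx h = trans (length-map suc (upTo (h ∸ 1))) (length-applyUpTo id (h ∸ 1))

lemma3p4 : (m r t : ℕ) (s : ℕ → ℕ) (k q h : ℕ) (x : ℕ → Fin q) →
    1 ≤ m → r ≤ t → t ≤ m → 1 ≤ t →
    (∀ i → 1 ≤ i → i ≤ t → 1 ≤ s i) →
    (∀ i → 1 ≤ i → i ≤ r → 2 ∣ s i) →
    (∀ i → r + 1 ≤ i → i ≤ t → ¬ (2 ∣ s i)) →
    (∀ i → 1 ≤ i → i < t → s (suc i) ∣ s i) →
    1 ≤ k → k ∣ lcm (s 1) 2 →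
    ∃ (λ n → q ≡ k + lcm (s 1) 2 * n) →
    1 ≤ h → h ≤ t →
    (∀ i → 1 ≤ i → i ≤ h ∸ 1 → ¬ (q ∣ s i * toℕ (x i))) →
    (∀ i j → 1 ≤ i → i < j → j ≤ h ∸ 1 → x i ≢ x j) →
    (∀ i j → 1 ≤ i → i < j → j ≤ h ∸ 1 → ¬ (q ∣ toℕ (x i) + toℕ (x j))) →
    (2 ∣ k → r + 1 ≤ h ∸ 1 → ∀ i → r + 1 ≤ i → i ≤ h ∸ 1 → toℕ (x i) ≢ q / 2) →
    cardSet q s h x ≡ gcd k (s h) + 2 * h ∸ 2
lemma3p4 m r t s k q h@(suc h′) x _ _ _ _ _ s-even _ s-chain 1≤k _ (n , q≡k+Ln) (s≤s z≤n) h≤t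
         sx≢0 x≢x′ x+x′≢0 x≢q/2 = begin
  cardSet q s h x
    ≡⟨ cardSet≡count q s h x ⟩
  count (λ y → (q ∣? s h * y) ⊎-dec any? (y ≡±?_) (map x (idx h))) q
    ≡⟨ count-annihilator∪± q (s h) (All.map⁺ (All-idx h sₕx≢0)) (All.map⁺ (All-idx h 2x≢0))
         (AllPairs.map⁺ (AllPairs-idx h λ i j 1≤i i<j j≤h′ →
           x≢x′ i j 1≤i i<j j≤h′ , x+x′≢0 i j 1≤i i<j j≤h′)) ⟩
  gcd q (s h) + length (map x (idx h)) * 2
    ≡⟨ cong₂ _+_ gcd[q,sₕ]≡gcd[k,sₕ] (cong (_* 2) (trans (length-map x (idx h)) (length-idx h))) ⟩
  gcd k (s h) + h′ * 2
    ≡⟨ m+n*2≡m+2*[1+n]∸2 (gcd k (s h)) h′ ⟩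
  gcd k (s h) + 2 * h ∸ 2 ∎
  where
  open ≡-Reasoning
  L : ℕ
  L = lcm (s 1) 2
  instance
    q≢0 : NonZero q
    q≢0 = >-nonZero (≤-trans 1≤k (subst (k ≤_) (sym q≡k+Ln) (m≤m+n k (L * n))))

  sₕ∣sᵢ : ∀ i → 1 ≤ i → i ≤ h → s h ∣ s i
  sₕ∣sᵢ i 1≤i i≤h = ∣-descending-chain s s-chain 1≤i i≤h h≤t

  gcd[q,sₕ]≡gcd[k,sₕ] : gcd q (s h) ≡ gcd k (s h)
  gcd[q,sₕ]≡gcd[k,sₕ] = trans (cong (λ z → gcd z (s h)) q≡k+Ln)
    (gcd[m+n,o]≡gcd[m,o] k (∣m⇒∣m*n n (∣-trans (sₕ∣sᵢ 1 ≤-refl (s≤s z≤n)) (m∣lcm[m,n] (s 1) 2))))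

  sₕx≢0 : ∀ i → 1 ≤ i → i ≤ h′ → ¬ q ∣ s h * toℕ (x i)
  sₕx≢0 i 1≤i i≤h′ q∣sₕx =
    sx≢0 i 1≤i i≤h′ (∣-trans q∣sₕx (*-monoˡ-∣ _ (sₕ∣sᵢ i 1≤i (m≤n⇒m≤1+n i≤h′))))

  2∣q⇒2∣k : 2 ∣ q → 2 ∣ k
  2∣q⇒2∣k 2∣q = ∣m+n∣m⇒∣n (subst (2 ∣_) (trans q≡k+Ln (+-comm k (L * n))) 2∣q)
                           (∣m⇒∣m*n n (n∣lcm[m,n] (s 1) 2))

  2x≢0 : ∀ i → 1 ≤ i → i ≤ h′ → ¬ q ∣ toℕ (x i) + toℕ (x i)
  2x≢0 i 1≤i i≤h′ = ¬∣a+a (toℕ<n (x i)) (sx≢0 i 1≤i i≤h′) (parity (i ≤? r))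
    where
    parity : Dec (i ≤ r) → 2 ∣ s i ⊎ (2 ∣ q → toℕ (x i) ≢ q / 2)
    parity (yes i≤r) = inj₁ (s-even i 1≤i i≤r)
    parity (no i≰r)  = inj₂ (λ 2∣q → x≢q/2 (2∣q⇒2∣k 2∣q) (≤-trans r+1≤i i≤h′) i r+1≤i i≤h′)
      where
      r+1≤i : r + 1 ≤ i
      r+1≤i = subst (_≤ i) (+-comm 1 r) (≰⇒> i≰r)
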